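{- Let $(a_i)_{i\ge1}$ be nonnegative integers with $a_1=1$, let $G(z,q)=\prod_{i\ge1}(1-zq^i)^{ -a_i}$, let $Q(q)=\sum_{j\ge0}c_jq^j$ be any formal power series, and let $F_n(z)=[q^n]\,G(z,q)Q(q)$. Then $[z^k]F_n(z)=[z^{k+1}]F_{n+1}(z)$ for all $n\ge0$ and $k\ge n/2$.
   Context: $[q^n]$ and $[z^k]$ denote coefficient extraction. -}

module Defs where

open import Level using (Level)
open import Data.Nat using (ℕ; zero; suc; _∸_; _≟_) renaming (_*_ to _*ℕ_)
open import Relation.Nullary using (yes; no)
open import Algebra.Bundles using (CommutativeRing)

-- Bivariate formal power series in z and q over a commutative ring R,
-- represented by coefficient functions:  f k m = [z^k q^m] f.
module Series {c ℓ : Level} (R : CommutativeRing c ℓ) where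
  open CommutativeRing R renaming (Carrier to A)

  PS2 : Set c
  PS2 = ℕ → ℕ → A

  sumUpTo : ℕ → (ℕ → A) → A
  sumUpTo zero    f = f 0
  sumUpTo (suc n) f = sumUpTo n f + f (suc n)

  mul : PS2 → PS2 → PS2
  mul f g k m = sumUpTo k λ i → sumUpTo m λ j → f i j * g (k ∸ i) (m ∸ j)

  one : PS2
  one zero zero = 1#
  one _    _    = 0#

  -- (1 - z q^i)^{-1} = Σ_{r ≥ 0} z^r q^{i r}
  geomInv : ℕ → PS2
  geomInv i k m with m ≟ i *ℕ k
  ... | yes _ = 1#
  ... | no  _ = 0#

  pow : PS2 → ℕ → PS2
  pow f zero    = one
  pow f (suc e) = mul (pow f e) f

  Gtrunc : (ℕ → ℕ) → ℕ → PS2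
  Gtrunc a zero    = one
  Gtrunc a (suc N) = mul (Gtrunc a N) (pow (geomInv (suc N)) (a (suc N)))

  -- G(z,q) = Π_{i≥1} (1 - z q^i)^{-a_i}; its q^m-coefficient only involves
  -- factors with i ≤ m, so it equals that of the truncation at N = m.
  G : (ℕ → ℕ) → PS2
  G a k m = Gtrunc a m k m

  liftQ : (ℕ → A) → PS2
  liftQ c zero    m = c m
  liftQ c (suc _) m = 0#

  -- [z^k] F_n(z) = [z^k q^n] G(z,q) Q(q)
  F : (ℕ → ℕ) → (ℕ → A) → ℕ → ℕ → A
  F a c n k = mul (G a) (liftQ c) k n

-- Split G = H · (1 - z q)⁻¹, where H = Π_{i≥2} (1 - z q^i)^{-a_i} has no
-- monomial z^k q^m with m < 2k, since each factor (1 - z q^i)⁻¹ with i ≥ 2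
-- only has monomials z^r q^{ir}.  Then G = H + z q G, so
-- [z^{k+1} q^{j+1}] G = [z^k q^j] G + [z^{k+1} q^{j+1}] H, and the last term
-- vanishes for j ≤ 2k.  Multiplying by Q(q), which carries no z, and reading
-- off q^{n+1} (resp. q^n) gives the claim for n ≤ 2k.
module Submission where

open import Defs
open import Level using (Level)
open import Data.Nat using (ℕ; zero; suc; _≤_; _<_; _*_; _∸_; _≟_; _<?_; z≤n; s≤s)
import Data.Nat.Properties as ℕₚ
open import Relation.Binary.PropositionalEquality using (_≡_)
import Relation.Binary.PropositionalEquality as ≡
open import Relation.Nullary using (yes; no; ¬_)
open import Data.Empty using (⊥-elim)
open import Algebra.Bundles using (CommutativeRing)
import Relation.Binary.Reasoning.Setoid as SetoidReasoning
import Algebra.Properties.CommutativeSemigroup as CommSemigroupProperties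

module SeriesProperties {c ℓ : Level} (R : CommutativeRing c ℓ) where
  open CommutativeRing R renaming (Carrier to A; _+_ to _+R_; _*_ to _*R_)
  open Series R
  open SetoidReasoning setoid
  open CommSemigroupProperties +-commutativeSemigroup using (interchange)

  sumUpTo-cong : ∀ n {f g : ℕ → A} → (∀ i → i ≤ n → f i ≈ g i) → sumUpTo n f ≈ sumUpTo n g
  sumUpTo-cong zero    f≈g = f≈g 0 z≤n
  sumUpTo-cong (suc n) f≈g =
    +-cong (sumUpTo-cong n (λ i i≤n → f≈g i (ℕₚ.m≤n⇒m≤1+n i≤n))) (f≈g (suc n) ℕₚ.≤-refl)

  sumUpTo-zero : ∀ n {f : ℕ → A} → (∀ i → i ≤ n → f i ≈ 0#) → sumUpTo n f ≈ 0#
  sumUpTo-zero n {f} f≈0 = trans (sumUpTo-cong n f≈0) (zeros n)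
    where
    zeros : ∀ n → sumUpTo n (λ _ → 0#) ≈ 0#
    zeros zero    = refl
    zeros (suc n) = trans (+-identityʳ _) (zeros n)

  sumUpTo-last : ∀ n {f : ℕ → A} → (∀ i → i < n → f i ≈ 0#) → sumUpTo n f ≈ f n
  sumUpTo-last zero    _   = refl
  sumUpTo-last (suc n) f≈0 =
    trans (+-congʳ (sumUpTo-zero n (λ i i≤n → f≈0 i (s≤s i≤n)))) (+-identityˡ _)

  sumUpTo-first : ∀ n {f : ℕ → A} → (∀ i → 0 < i → i ≤ n → f i ≈ 0#) → sumUpTo n f ≈ f 0
  sumUpTo-first zero    _   = refl
  sumUpTo-first (suc n) f≈0 =
    trans (+-cong (sumUpTo-first n (λ i 0<i i≤n → f≈0 i 0<i (ℕₚ.m≤n⇒m≤1+n i≤n)))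
                  (f≈0 (suc n) (s≤s z≤n) ℕₚ.≤-refl))
          (+-identityʳ _)

  sumUpTo-suc : ∀ n (f : ℕ → A) → sumUpTo (suc n) f ≈ f 0 +R sumUpTo n (λ i → f (suc i))
  sumUpTo-suc zero    f = refl
  sumUpTo-suc (suc n) f = trans (+-congʳ (sumUpTo-suc n f)) (+-assoc _ _ _)

  sumUpTo-+ : ∀ n (f g : ℕ → A) → sumUpTo n (λ i → f i +R g i) ≈ sumUpTo n f +R sumUpTo n g
  sumUpTo-+ zero    f g = refl
  sumUpTo-+ (suc n) f g = trans (+-congʳ (sumUpTo-+ n f g)) (interchange _ _ _ _)

  _≈ₛ_ : PS2 → PS2 → Set ℓ
  f ≈ₛ g = ∀ k m → f k m ≈ g k m

  mul-congˡ : ∀ {f f′} g → f ≈ₛ f′ → mul f g ≈ₛ mul f′ g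
  mul-congˡ g f≈f′ k m = sumUpTo-cong k (λ i _ → sumUpTo-cong m (λ j _ → *-congʳ (f≈f′ i j)))

  mul-distribʳ : ∀ f f′ g → mul (λ k m → f k m +R f′ k m) g ≈ₛ λ k m → mul f g k m +R mul f′ g k m
  mul-distribʳ f f′ g k m =
    trans (sumUpTo-cong k (λ i _ → trans (sumUpTo-cong m (λ j _ → distribʳ _ _ _)) (sumUpTo-+ m _ _)))
          (sumUpTo-+ k _ _)

  one-q>0 : ∀ k m → 0 < m → one k m ≈ 0#
  one-q>0 zero    (suc m) _ = refl
  one-q>0 (suc k) (suc m) _ = refl

  one-z>0 : ∀ k m → 0 < k → one k m ≈ 0#
  one-z>0 (suc k) m _ = refl

  mul-identityˡ : ∀ g → mul one g ≈ₛ g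
  mul-identityˡ g k m = begin
      sumUpTo k (λ i → sumUpTo m (λ j → one i j *R g (k ∸ i) (m ∸ j)))
    ≈⟨ sumUpTo-first k (λ i 0<i _ → sumUpTo-zero m (λ j _ → trans (*-congʳ (one-z>0 i j 0<i)) (zeroˡ _))) ⟩
      sumUpTo m (λ j → one 0 j *R g k (m ∸ j))
    ≈⟨ sumUpTo-first m (λ j 0<j _ → trans (*-congʳ (one-q>0 0 j 0<j)) (zeroˡ _)) ⟩
      1# *R g k m
    ≈⟨ *-identityˡ _ ⟩
      g k m ∎

  mul-identityʳ-upTo : ∀ f g m → (∀ k′ m′ → m′ ≤ m → g k′ m′ ≈ one k′ m′) → ∀ k → mul f g k m ≈ f k m
  mul-identityʳ-upTo f g m g≈one k = begin
      sumUpTo k (λ i → sumUpTo m (λ j → f i j *R g (k ∸ i) (m ∸ j)))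
    ≈⟨ sumUpTo-cong k (λ i _ → sumUpTo-last m (λ j j<m →
         vanish j (one-q>0 (k ∸ i) (m ∸ j) (ℕₚ.m<n⇒0<n∸m j<m)))) ⟩
      sumUpTo k (λ i → f i m *R g (k ∸ i) (m ∸ m))
    ≈⟨ sumUpTo-last k (λ i i<k → vanish m (one-z>0 (k ∸ i) (m ∸ m) (ℕₚ.m<n⇒0<n∸m i<k))) ⟩
      f k m *R g (k ∸ k) (m ∸ m)
    ≈⟨ *-congˡ (g≈one _ _ (ℕₚ.m∸n≤m m m)) ⟩
      f k m *R one (k ∸ k) (m ∸ m)
    ≈⟨ *-congˡ (reflexive (≡.cong₂ one (ℕₚ.n∸n≡0 k) (ℕₚ.n∸n≡0 m))) ⟩
      f k m *R 1#
    ≈⟨ *-identityʳ _ ⟩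
      f k m ∎
    where
    vanish : ∀ {x k′} j → one k′ (m ∸ j) ≈ 0# → x *R g k′ (m ∸ j) ≈ 0#
    vanish j one≈0 = trans (*-congˡ (trans (g≈one _ _ (ℕₚ.m∸n≤m m j)) one≈0)) (zeroʳ _)

  geomInv-on : ∀ i k m → m ≡ i * k → geomInv i k m ≈ 1#
  geomInv-on i k m m≡ik with m ≟ i * k
  ... | yes _    = refl
  ... | no  m≢ik = ⊥-elim (m≢ik m≡ik)

  geomInv-off : ∀ i k m → ¬ m ≡ i * k → geomInv i k m ≈ 0#
  geomInv-off i k m m≢ik with m ≟ i * k
  ... | yes m≡ik = ⊥-elim (m≢ik m≡ik)
  ... | no  _    = refl

  geomInv-upTo : ∀ N k m → m ≤ N → geomInv (suc N) k m ≈ one k m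
  geomInv-upTo N zero    zero    _   = geomInv-on (suc N) 0 0 (≡.sym (ℕₚ.*-zeroʳ N))
  geomInv-upTo N zero    (suc m) _   = geomInv-off (suc N) 0 (suc m) (λ m+1≡0 →
    ℕₚ.1+n≢0 (≡.trans m+1≡0 (ℕₚ.*-zeroʳ N)))
  geomInv-upTo N (suc k) m       m≤N = geomInv-off (suc N) (suc k) m (λ m≡ →
    ℕₚ.<⇒≱ (s≤s m≤N) (≡.subst (suc N ≤_) (≡.sym m≡) (ℕₚ.m≤m*n (suc N) (suc k))))

  pow-geomInv-upTo : ∀ N e k m → m ≤ N → pow (geomInv (suc N)) e k m ≈ one k m
  pow-geomInv-upTo N zero    k m _   = refl
  pow-geomInv-upTo N (suc e) k m m≤N =
    trans (mul-identityʳ-upTo _ _ m (λ k′ m′ m′≤m → geomInv-upTo N k′ m′ (ℕₚ.≤-trans m′≤m m≤N)) k)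
          (pow-geomInv-upTo N e k m m≤N)

  Gtrunc-stable : ∀ a N k m → m ≤ N → Gtrunc a (suc N) k m ≈ Gtrunc a N k m
  Gtrunc-stable a N k m m≤N =
    mul-identityʳ-upTo _ _ m (λ k′ m′ m′≤m → pow-geomInv-upTo N (a (suc N)) k′ m′ (ℕₚ.≤-trans m′≤m m≤N)) k

  VanishesBelow2z : PS2 → Set ℓ
  VanishesBelow2z f = ∀ k m → m < 2 * k → f k m ≈ 0#

  one-vanishesBelow2z : VanishesBelow2z one
  one-vanishesBelow2z (suc k) m _ = refl

  m∸j<2[k∸i] : ∀ i j k m → j ≤ m → m < 2 * k → 2 * i ≤ j → m ∸ j < 2 * (k ∸ i)
  m∸j<2[k∸i] i j k m j≤m m<2k 2i≤j =
    ℕₚ.≤-<-trans (ℕₚ.∸-monoʳ-≤ m 2i≤j)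
      (≡.subst (m ∸ 2 * i <_) (≡.sym (ℕₚ.*-distribˡ-∸ 2 k i))
        (ℕₚ.∸-monoˡ-< m<2k (ℕₚ.≤-trans 2i≤j j≤m)))

  mul-vanishesBelow2z : ∀ {f g} → VanishesBelow2z f → VanishesBelow2z g → VanishesBelow2z (mul f g)
  mul-vanishesBelow2z {f} {g} f↓ g↓ k m m<2k =
    sumUpTo-zero k (λ i _ → sumUpTo-zero m (λ j j≤m → term i j j≤m))
    where
    term : ∀ i j → j ≤ m → f i j *R g (k ∸ i) (m ∸ j) ≈ 0#
    term i j j≤m with j <? 2 * i
    ... | yes j<2i = trans (*-congʳ (f↓ i j j<2i)) (zeroˡ _)
    ... | no  j≮2i = trans (*-congˡ (g↓ _ _ (m∸j<2[k∸i] i j k m j≤m m<2k (ℕₚ.≮⇒≥ j≮2i)))) (zeroʳ _)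

  pow-vanishesBelow2z : ∀ {f} e → VanishesBelow2z f → VanishesBelow2z (pow f e)
  pow-vanishesBelow2z zero    f↓ = one-vanishesBelow2z
  pow-vanishesBelow2z (suc e) f↓ = mul-vanishesBelow2z (pow-vanishesBelow2z e f↓) f↓

  geomInv-vanishesBelow2z : ∀ i → 2 ≤ i → VanishesBelow2z (geomInv i)
  geomInv-vanishesBelow2z i 2≤i k m m<2k = geomInv-off i k m (λ m≡ik →
    ℕₚ.<⇒≱ m<2k (≡.subst (2 * k ≤_) (≡.sym m≡ik) (ℕₚ.*-monoˡ-≤ k 2≤i)))

  -- Gtail a N = Π_{i=2}^{N+1} (1 - z q^i)^{-a_i}, the factor i = 1 removed from Gtrunc a (N + 1).
  Gtail : (ℕ → ℕ) → ℕ → PS2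
  Gtail a zero    = one
  Gtail a (suc N) = mul (Gtail a N) (pow (geomInv (suc (suc N))) (a (suc (suc N))))

  Gtail-vanishesBelow2z : ∀ a N → VanishesBelow2z (Gtail a N)
  Gtail-vanishesBelow2z a zero    = one-vanishesBelow2z
  Gtail-vanishesBelow2z a (suc N) =
    mul-vanishesBelow2z (Gtail-vanishesBelow2z a N)
      (pow-vanishesBelow2z (a (suc (suc N))) (geomInv-vanishesBelow2z (suc (suc N)) (s≤s (s≤s z≤n))))

  mulZQ : PS2 → PS2
  mulZQ f zero    m       = 0#
  mulZQ f (suc k) zero    = 0#
  mulZQ f (suc k) (suc m) = f k m

  mulZQ-q⁰ : ∀ f k → mulZQ f k 0 ≈ 0#
  mulZQ-q⁰ f zero    = refl
  mulZQ-q⁰ f (suc k) = refl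

  mulZQ-cong : ∀ {f f′} → f ≈ₛ f′ → mulZQ f ≈ₛ mulZQ f′
  mulZQ-cong f≈f′ zero    m       = refl
  mulZQ-cong f≈f′ (suc k) zero    = refl
  mulZQ-cong f≈f′ (suc k) (suc m) = f≈f′ k m

  mul-mulZQ : ∀ f g → mul (mulZQ f) g ≈ₛ mulZQ (mul f g)
  mul-mulZQ f g zero    m       = sumUpTo-zero m (λ _ _ → zeroˡ _)
  mul-mulZQ f g (suc k) zero    = sumUpTo-zero (suc k) (λ i _ → trans (*-congʳ (mulZQ-q⁰ f i)) (zeroˡ _))
  mul-mulZQ f g (suc k) (suc m) =
    trans (sumUpTo-suc k _)
      (trans (+-cong (sumUpTo-zero (suc m) (λ _ _ → zeroˡ _))
                     (sumUpTo-cong k (λ i _ → trans (sumUpTo-suc m _) (trans (+-congʳ (zeroˡ _)) (+-identityˡ _)))))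
             (+-identityˡ _))

  -- (1 - z q) f = h, stated without subtraction.
  Div1-zq : PS2 → PS2 → Set ℓ
  Div1-zq f h = f ≈ₛ λ k m → h k m +R mulZQ f k m

  Div1-zq-cong : ∀ {f f′ h} → f ≈ₛ f′ → Div1-zq f h → Div1-zq f′ h
  Div1-zq-cong f≈f′ f÷ k m = trans (sym (f≈f′ k m)) (trans (f÷ k m) (+-congˡ (mulZQ-cong f≈f′ k m)))

  Div1-zq-mul : ∀ {f h} g → Div1-zq f h → Div1-zq (mul f g) (mul h g)
  Div1-zq-mul {f} {h} g f÷ k m =
    trans (mul-congˡ g f÷ k m) (trans (mul-distribʳ h (mulZQ f) g k m) (+-congˡ (mul-mulZQ f g k m)))

  geomInv1-step : ∀ k m → geomInv 1 (suc k) (suc m) ≈ geomInv 1 k m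
  geomInv1-step k m with m ≟ k
  ... | yes m≡k = trans (geomInv-on 1 (suc k) (suc m) (≡.trans (≡.cong suc m≡k) (≡.sym (ℕₚ.*-identityˡ (suc k)))))
                        (sym (geomInv-on 1 k m (≡.trans m≡k (≡.sym (ℕₚ.*-identityˡ k)))))
  ... | no  m≢k = trans (geomInv-off 1 (suc k) (suc m) (λ e → m≢k (ℕₚ.suc-injective (≡.trans e (ℕₚ.*-identityˡ (suc k))))))
                        (sym (geomInv-off 1 k m (λ e → m≢k (≡.trans e (ℕₚ.*-identityˡ k)))))

  geomInv1-div1-zq : Div1-zq (geomInv 1) one
  geomInv1-div1-zq zero    zero    = sym (+-identityʳ _)
  geomInv1-div1-zq zero    (suc m) = trans (geomInv-off 1 0 (suc m) (λ ())) (sym (+-identityʳ _))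
  geomInv1-div1-zq (suc k) zero    = trans (geomInv-off 1 (suc k) 0 (λ ())) (sym (+-identityʳ _))
  geomInv1-div1-zq (suc k) (suc m) = trans (geomInv1-step k m) (sym (+-identityˡ _))

  Gtrunc-div1-zq : ∀ a → a 1 ≡ 1 → ∀ N → Div1-zq (Gtrunc a (suc N)) (Gtail a N)
  Gtrunc-div1-zq a a₁≡1 zero rewrite a₁≡1 =
    Div1-zq-cong (λ k m → sym (trans (mul-identityˡ (mul one (geomInv 1)) k m) (mul-identityˡ (geomInv 1) k m)))
                 geomInv1-div1-zq
  Gtrunc-div1-zq a a₁≡1 (suc N) = Div1-zq-mul (pow (geomInv (suc (suc N))) (a (suc (suc N)))) (Gtrunc-div1-zq a a₁≡1 N)

  G-shift : ∀ a → a 1 ≡ 1 → ∀ k j → j ≤ 2 * k → G a (suc k) (suc j) ≈ G a k j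
  G-shift a a₁≡1 k j j≤2k = begin
      Gtrunc a (suc j) (suc k) (suc j)
    ≈⟨ Gtrunc-div1-zq a a₁≡1 j (suc k) (suc j) ⟩
      Gtail a j (suc k) (suc j) +R Gtrunc a (suc j) k j
    ≈⟨ +-cong (Gtail-vanishesBelow2z a j (suc k) (suc j) j+1<2k+2) (Gtrunc-stable a j k j ℕₚ.≤-refl) ⟩
      0# +R Gtrunc a j k j
    ≈⟨ +-identityˡ _ ⟩
      Gtrunc a j k j ∎
    where
    j+1<2k+2 : suc j < 2 * suc k
    j+1<2k+2 = ≡.subst (suc j <_) (≡.sym (ℕₚ.*-suc 2 k)) (s≤s (s≤s j≤2k))

  F-as-sum : ∀ a Q n k → F a Q n k ≈ sumUpTo n (λ j → G a k j *R Q (n ∸ j))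
  F-as-sum a Q n k =
    trans (sumUpTo-last k (λ i i<k → sumUpTo-zero n (λ j _ → trans (*-congˡ (liftQ-z>0 (ℕₚ.m<n⇒0<n∸m i<k))) (zeroʳ _))))
          (sumUpTo-cong n (λ j _ → *-congˡ (reflexive (≡.cong (λ k′ → liftQ Q k′ (n ∸ j)) (ℕₚ.n∸n≡0 k)))))
    where
    liftQ-z>0 : ∀ {k′ m} → 0 < k′ → liftQ Q k′ m ≈ 0#
    liftQ-z>0 {suc _} _ = refl

lemma10 : {c ℓ : Level} (R : CommutativeRing c ℓ) (a : ℕ → ℕ) → a 1 ≡ 1 →
    (Q : ℕ → CommutativeRing.Carrier R) → (n k : ℕ) → n ≤ 2 * k →
    CommutativeRing._≈_ R (Series.F R a Q n k) (Series.F R a Q (suc n) (suc k))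
lemma10 R a a₁≡1 Q n k n≤2k = sym (begin
    F a Q (suc n) (suc k)
  ≈⟨ F-as-sum a Q (suc n) (suc k) ⟩
    sumUpTo (suc n) (λ j → G a (suc k) j *R Q (suc n ∸ j))
  ≈⟨ sumUpTo-suc n _ ⟩
    G a (suc k) 0 *R Q (suc n) +R sumUpTo n (λ j → G a (suc k) (suc j) *R Q (n ∸ j))
  ≈⟨ +-cong (zeroˡ _) (sumUpTo-cong n (λ j j≤n → *-congʳ (G-shift a a₁≡1 k j (ℕₚ.≤-trans j≤n n≤2k)))) ⟩
    0# +R sumUpTo n (λ j → G a k j *R Q (n ∸ j))
  ≈⟨ +-identityˡ _ ⟩
    sumUpTo n (λ j → G a k j *R Q (n ∸ j))
  ≈⟨ F-as-sum a Q n k ⟨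
    F a Q n k ∎)
  where
  open CommutativeRing R renaming (_+_ to _+R_; _*_ to _*R_)
  open Series R
  open SeriesProperties R
  open SetoidReasoning setoid
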